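{- Let $G$ and $H$ be finite simple graphs with $G\in\mathfrak{F}$. Then $$\gamma_R(G\Box H)\ge \frac{1}{2}\max\left\{\gamma(G)\left(\gamma_R(H)+\gamma(H)\right),\ \gamma(H)\left(\gamma_R(G)+\gamma(G)\right)\right\}.$$
   Context: $\gamma(X)$ denotes the domination number of a graph $X$ (minimum size of a set $D$ such that every vertex outside $D$ has a neighbor in $D$). A Roman dominating function on $X$ is a map $f:V(X)\to\{0,1,2\}$ such that every vertex $v$ with $f(v)=0$ has a neighbor $u$ with $f(u)=2$; $\gamma_R(X)$ is the minimum of $\sum_v f(v)$ over such $f$. $\mathfrak{F}$ is the class of graphs $G$ having a dominating set $S=\{u_1,\dots,u_{\gamma(G)}\}$ of size $\gamma(G)$ with $N[u_i]\cap N[u_j]=\emptyset$ for all $i\ne j$ (an efficient dominating set, equivalently a perfect code), where $N[u]$ is the closed neighborhood of $u$. The Cartesian product $G\Box H$ has vertex set $V(G)\times V(H)$, with $(g,h)\sim(g',h')$ iff ($g=g'$ and $h\sim h'$) or ($g\sim g'$ and $h=h'$). -}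

module Defs where

open import Level using (0ℓ)
open import Data.Nat using (ℕ; zero; suc; _+_; _*_; _≤_)
open import Data.Fin using (Fin; remQuot)
open import Data.Fin.Subset using (Subset; _∈_; _∉_; ∣_∣)
open import Data.Vec using (tabulate)
open import Data.Vec using () renaming (sum to vsum)
open import Data.Product using (Σ; ∃; ∃-syntax; _×_; _,_; proj₁; proj₂)
open import Data.Sum using (_⊎_)
open import Relation.Nullary using (¬_)
open import Relation.Binary.PropositionalEquality using (_≡_; _≢_)

record Graph : Set₁ where
  field
    n     : ℕ
    Adj   : Fin n → Fin n → Set
    sym   : ∀ {u v} → Adj u v → Adj v u
    irrefl : ∀ {u} → ¬ Adj u u
open Graph public

InClosedNbhd : (G : Graph) → Fin (n G) → Fin (n G) → Set
InClosedNbhd G u w = (w ≡ u) ⊎ Adj G u w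

IsDominating : (G : Graph) → Subset (n G) → Set
IsDominating G D = ∀ v → v ∉ D → ∃[ u ] (u ∈ D × Adj G v u)

IsDominationNumber : Graph → ℕ → Set
IsDominationNumber G k =
  (∃[ D ] (IsDominating G D × ∣ D ∣ ≡ k))
  × (∀ D → IsDominating G D → k ≤ ∣ D ∣)

data R3 : Set where
  r0 r1 r2 : R3

val : R3 → ℕ
val r0 = 0
val r1 = 1
val r2 = 2

IsRomanDominating : (G : Graph) → (Fin (n G) → R3) → Set
IsRomanDominating G f = ∀ v → f v ≡ r0 → ∃[ u ] (Adj G v u × f u ≡ r2)

weight : (G : Graph) → (Fin (n G) → R3) → ℕ
weight G f = vsum (tabulate (λ v → val (f v)))

IsRomanDominationNumber : Graph → ℕ → Set
IsRomanDominationNumber G k =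
  (∃[ f ] (IsRomanDominating G f × weight G f ≡ k))
  × (∀ f → IsRomanDominating G f → k ≤ weight G f)

InF : Graph → Set
InF G = ∃[ S ] (IsDominating G S
               × (∀ k → IsDominationNumber G k → ∣ S ∣ ≡ k)
               × (∀ u v → u ∈ S → v ∈ S → u ≢ v →
                    ∀ w → ¬ (InClosedNbhd G u w × InClosedNbhd G v w)))

-- Cartesian product G □ H on Fin (n G * n H); vertex x corresponds to remQuot x.
□-Adj : (G H : Graph) → Fin (n G * n H) → Fin (n G * n H) → Set
□-Adj G H x y with remQuot {n G} (n H) x | remQuot {n G} (n H) y
... | (g , h) | (g' , h') = (g ≡ g' × Adj H h h') ⊎ (Adj G g g' × h ≡ h')

open import Data.Sum using (inj₁; inj₂)
open import Relation.Binary.PropositionalEquality using (refl)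
import Relation.Binary.PropositionalEquality as Eq

□-sym : (G H : Graph) → ∀ {x y} → □-Adj G H x y → □-Adj G H y x
□-sym G H {x} {y} a with remQuot {n G} (n H) x | remQuot {n G} (n H) y
□-sym G H (inj₁ (e , a)) | (g , h) | (g' , h') = inj₁ (Eq.sym e , sym H a)
□-sym G H (inj₂ (a , e)) | (g , h) | (g' , h') = inj₂ (sym G a , Eq.sym e)

□-irrefl : (G H : Graph) → ∀ {x} → ¬ □-Adj G H x x
□-irrefl G H {x} a with remQuot {n G} (n H) x
□-irrefl G H (inj₁ (_ , a)) | (g , h) = irrefl H a
□-irrefl G H (inj₂ (a , _)) | (g , h) = irrefl G a

_□_ : Graph → Graph → Graph
G □ H = record { n = n G * n H ; Adj = □-Adj G H ; sym = □-sym G H ; irrefl = □-irrefl G H }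

-- Fix a Roman dominating function f of G □ H of weight w with t cells labelled 2, an efficient
-- dominating set S of G and a minimum dominating set D of H.  The closed neighbourhoods N[u],
-- u ∈ S, partition G, so G □ H splits into γ(G) blocks N[u] × H.  If the column N[u] × {h} of a
-- block has weight 0, the 2-neighbour of (u , h) cannot lie in that column, so it lies in
-- {u} × H.  Hence projecting a block onto H yields a dominating set (its support) and a Roman
-- dominating function, giving γ(H)·γ(G) + t ≤ w and γR(H)·γ(G) ≤ w.  Sending every vertex of H
-- to a dominator in D splits G □ H into γ(H) slices G × α⁻¹(d), and collapsing a slice onto G is
-- Roman dominating once each row whose cells are all 0s dominated inside their copy of H is
-- labelled 1.  In each row g these extra labels are paid for by the 2s of row g, since trading
-- the covered members of D for them still dominates H; so γR(G)·γ(H) ≤ w + t.  Adding the first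
-- bound to each of the others yields both halves of the maximum.
module Submission where

open import Defs renaming (sym to Adj-sym)

open import Data.Bool using (Bool; true; false; not; _∧_; _∨_)
import Data.Bool.Properties as Bool
open import Data.Nat using (ℕ; zero; suc; _+_; _*_; _⊔_; _≤_; _<_; _<ᵇ_; z≤n; s≤s)
open import Data.Nat.Properties hiding (_≟_)
open import Data.Fin using (Fin; zero; suc; combine; remQuot; _↑ˡ_; _↑ʳ_)
open import Data.Fin.Properties using (_≟_; all?; ¬∀⟶∃¬; remQuot-combine; combine-remQuot)
open import Data.Fin.Subset using (Subset; _∈_; _∉_; ∣_∣)
open import Data.Fin.Subset.Properties using (_∈?_)
open import Data.Vec using ([]; _∷_; lookup; tabulate)
open import Data.Vec.Properties using (lookup∘tabulate; []=⇒lookup; lookup⇒[]=)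
import Data.Vec as Vec
open import Function using (_∘_; case_of_)
open import Data.Product using (_×_; _,_; proj₁; proj₂; ∃-syntax)
open import Data.Sum using (_⊎_; inj₁; inj₂; [_,_])
open import Data.Empty using (⊥-elim)
open import Relation.Nullary using (¬_; Dec; does; yes; no)
open import Relation.Nullary.Decidable using (decidable-stable; dec-true; dec-false; _→-dec_)
open import Relation.Binary.PropositionalEquality
  using (_≡_; _≢_; refl; sym; trans; cong; cong₂; subst; module ≡-Reasoning)
open import Algebra.Properties.Semiring.Sum +-*-semiring
  using (sum; sum-syntax; sum-cong-≗; ∑-distrib-+; ∑-comm; *-distribˡ-sum; sum-replicate-zero)
open import Algebra.Properties.CommutativeSemigroup *-commutativeSemigroup using (x∙yz≈y∙xz)

𝟙 : Bool → ℕ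
𝟙 true  = 1
𝟙 false = 0

𝟙-∧ : ∀ a b → 𝟙 (a ∧ b) ≡ 𝟙 a * 𝟙 b
𝟙-∧ true  b = sym (+-identityʳ (𝟙 b))
𝟙-∧ false b = refl

𝟙-∨ : ∀ a b → 𝟙 (a ∨ b) ≤ 𝟙 a + 𝟙 b
𝟙-∨ true  b = s≤s z≤n
𝟙-∨ false b = ≤-refl

𝟙+𝟙-not : ∀ b → 𝟙 b + 𝟙 (not b) ≡ 1
𝟙+𝟙-not true  = refl
𝟙+𝟙-not false = refl

sum-mono-≤ : ∀ {n} {f g : Fin n → ℕ} → (∀ i → f i ≤ g i) → sum f ≤ sum g
sum-mono-≤ {zero}  f≤g = z≤n
sum-mono-≤ {suc n} f≤g = +-mono-≤ (f≤g zero) (sum-mono-≤ (f≤g ∘ suc))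

term≤sum : ∀ {n} (f : Fin n → ℕ) i → f i ≤ sum f
term≤sum f zero    = m≤m+n (f zero) _
term≤sum f (suc i) = ≤-trans (term≤sum (f ∘ suc) i) (m≤n+m _ (f zero))

sum-tabulate : ∀ {n} (f : Fin n → ℕ) → Vec.sum (tabulate f) ≡ sum f
sum-tabulate {zero}  f = refl
sum-tabulate {suc n} f = cong (f zero +_) (sum-tabulate (f ∘ suc))

sum-↑ : ∀ m n (f : Fin (m + n) → ℕ) → sum f ≡ sum (f ∘ (_↑ˡ n)) + sum (f ∘ (m ↑ʳ_))
sum-↑ zero    n f = refl
sum-↑ (suc m) n f = trans (cong (f zero +_) (sum-↑ m n (f ∘ suc))) (sym (+-assoc (f zero) _ _))

sum-combine : ∀ m n (f : Fin (m * n) → ℕ) → sum f ≡ ∑[ i < m ] ∑[ j < n ] f (combine i j)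
sum-combine zero    n f = refl
sum-combine (suc m) n f =
  trans (sum-↑ n (m * n) f) (cong (sum (f ∘ (_↑ˡ m * n)) +_) (sum-combine m n (f ∘ (n ↑ʳ_))))

∣p∣≡∑𝟙 : ∀ {n} (p : Subset n) → ∣ p ∣ ≡ ∑[ i < n ] 𝟙 (lookup p i)
∣p∣≡∑𝟙 []          = refl
∣p∣≡∑𝟙 (true ∷ p)  = cong suc (∣p∣≡∑𝟙 p)
∣p∣≡∑𝟙 (false ∷ p) = ∣p∣≡∑𝟙 p

∣tabulate∣ : ∀ {n} (b : Fin n → Bool) → ∣ tabulate b ∣ ≡ ∑[ i < n ] 𝟙 (b i)
∣tabulate∣ b = trans (∣p∣≡∑𝟙 (tabulate b)) (sum-cong-≗ (cong 𝟙 ∘ lookup∘tabulate b))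

sum-𝟙≟ : ∀ {n} (c : Fin n) (f : Fin n → ℕ) → ∑[ i < n ] (𝟙 (does (c ≟ i)) * f i) ≡ f c
sum-𝟙≟ {suc n} zero    f =
  trans (cong (f zero + 0 +_) (sum-replicate-zero n)) (trans (+-identityʳ _) (+-identityʳ _))
sum-𝟙≟ {suc n} (suc c) f = sum-𝟙≟ c (f ∘ suc)

sumOver : ∀ {n} → (Fin n → Bool) → (Fin n → ℕ) → ℕ
sumOver P f = sum (λ i → 𝟙 (P i) * f i)

sumOver-cong : ∀ {n} (P : Fin n → Bool) {f g : Fin n → ℕ} → (∀ i → f i ≡ g i) →
  sumOver P f ≡ sumOver P g
sumOver-cong P f≗g = sum-cong-≗ λ i → cong (𝟙 (P i) *_) (f≗g i)

sumOver-mono-≤ : ∀ {n} (P : Fin n → Bool) {f g : Fin n → ℕ} →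
  (∀ i → P i ≡ true → f i ≤ g i) → sumOver P f ≤ sumOver P g
sumOver-mono-≤ P f≤g = sum-mono-≤ λ i → mono (P i) (f≤g i)
  where
  mono : ∀ b {x y} → (b ≡ true → x ≤ y) → 𝟙 b * x ≤ 𝟙 b * y
  mono true  x≤y = *-monoʳ-≤ 1 (x≤y refl)
  mono false _   = z≤n

term≤sumOver : ∀ {n} (P : Fin n → Bool) (f : Fin n → ℕ) i → P i ≡ true → f i ≤ sumOver P f
term≤sumOver P f i Pi =
  ≤-trans (≤-reflexive (sym (trans (cong (λ b → 𝟙 b * f i) Pi) (+-identityʳ (f i)))))
          (term≤sum (λ i → 𝟙 (P i) * f i) i)

sumOver-distrib-+ : ∀ {n} (P : Fin n → Bool) (f g : Fin n → ℕ) →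
  sumOver P (λ i → f i + g i) ≡ sumOver P f + sumOver P g
sumOver-distrib-+ P f g = trans (sum-cong-≗ λ i → *-distribˡ-+ (𝟙 (P i)) (f i) (g i))
                                 (∑-distrib-+ (λ i → 𝟙 (P i) * f i) (λ i → 𝟙 (P i) * g i))

sumOver-sum-comm : ∀ {n m} (P : Fin n → Bool) (f : Fin n → Fin m → ℕ) →
  sumOver P (λ i → ∑[ j < m ] f i j) ≡ ∑[ j < m ] sumOver P (λ i → f i j)
sumOver-sum-comm P f = trans (sum-cong-≗ λ i → *-distribˡ-sum (𝟙 (P i)) (f i))
                             (∑-comm (λ i j → 𝟙 (P i) * f i j))

sumOver-const : ∀ {n} (p : Subset n) c → sumOver (lookup p) (λ _ → c) ≡ c * ∣ p ∣
sumOver-const p c = begin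
  sum (λ i → 𝟙 (lookup p i) * c)  ≡⟨ sum-cong-≗ (λ i → *-comm (𝟙 (lookup p i)) c) ⟩
  sum (λ i → c * 𝟙 (lookup p i))  ≡⟨ *-distribˡ-sum c (𝟙 ∘ lookup p) ⟨
  c * sum (λ i → 𝟙 (lookup p i))  ≡⟨ cong (c *_) (∣p∣≡∑𝟙 p) ⟨
  c * ∣ p ∣                        ∎
  where open ≡-Reasoning

Fibre : ∀ {m n} → (Fin m → Fin n) → Fin n → Fin m → Bool
Fibre c d i = does (c i ≟ d)

sumOver-fibres : ∀ {m n} (P : Fin n → Bool) (c : Fin m → Fin n) → (∀ i → P (c i) ≡ true) →
  (V : Fin m → ℕ) → sumOver P (λ d → sumOver (Fibre c d) V) ≡ sum V
sumOver-fibres {m} {n} P c P∘c V = begin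
  sumOver P (λ d → ∑[ i < m ] (𝟙 (Fibre c d i) * V i))
    ≡⟨ sumOver-sum-comm P (λ d i → 𝟙 (Fibre c d i) * V i) ⟩
  ∑[ i < m ] ∑[ d < n ] (𝟙 (P d) * (𝟙 (Fibre c d i) * V i))
    ≡⟨ sum-cong-≗ (λ i → sum-cong-≗ (λ d → x∙yz≈y∙xz (𝟙 (P d)) (𝟙 (Fibre c d i)) (V i))) ⟩
  ∑[ i < m ] ∑[ d < n ] (𝟙 (Fibre c d i) * (𝟙 (P d) * V i))
    ≡⟨ sum-cong-≗ (λ i → sum-𝟙≟ (c i) (λ d → 𝟙 (P d) * V i)) ⟩
  ∑[ i < m ] (𝟙 (P (c i)) * V i)
    ≡⟨ sum-cong-≗ (λ i → trans (cong (λ b → 𝟙 b * V i) (P∘c i)) (+-identityʳ (V i))) ⟩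
  sum V
    ∎
  where open ≡-Reasoning

sumOver-fibres₂ : ∀ {m n k} (P : Fin n → Bool) (c : Fin m → Fin n) → (∀ i → P (c i) ≡ true) →
  (V : Fin m → Fin k → ℕ) →
  sumOver P (λ d → ∑[ j < k ] sumOver (Fibre c d) (λ i → V i j)) ≡ ∑[ i < m ] ∑[ j < k ] V i j
sumOver-fibres₂ P c P∘c V =
  trans (sumOver-cong P (λ d → sym (sumOver-sum-comm (Fibre c d) V))) (sumOver-fibres P c P∘c (sum ∘ V))

2*m≡m+m : ∀ m → 2 * m ≡ m + m
2*m≡m+m m = cong (m +_) (+-identityʳ m)

isTwo : R3 → Bool
isTwo r2 = true
isTwo _  = false

2*𝟙-isTwo≤val : ∀ v → 2 * 𝟙 (isTwo v) ≤ val v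
2*𝟙-isTwo≤val r0 = z≤n
2*𝟙-isTwo≤val r1 = z≤n
2*𝟙-isTwo≤val r2 = ≤-refl

val≤0⇒r0 : ∀ {v} → val v ≤ 0 → v ≡ r0
val≤0⇒r0 {r0} _ = refl

2*twos≤weight : ∀ {k} (P : Fin k → Bool) (v : Fin k → R3) →
  2 * sumOver P (𝟙 ∘ isTwo ∘ v) ≤ sumOver P (val ∘ v)
2*twos≤weight P v = begin
  2 * sumOver P (𝟙 ∘ isTwo ∘ v)
    ≡⟨ *-distribˡ-sum 2 (λ i → 𝟙 (P i) * 𝟙 (isTwo (v i))) ⟩
  sum (λ i → 2 * (𝟙 (P i) * 𝟙 (isTwo (v i))))
    ≡⟨ sum-cong-≗ (λ i → x∙yz≈y∙xz 2 (𝟙 (P i)) _) ⟩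
  sum (λ i → 𝟙 (P i) * (2 * 𝟙 (isTwo (v i))))
    ≤⟨ sum-mono-≤ (λ i → *-monoʳ-≤ (𝟙 (P i)) (2*𝟙-isTwo≤val (v i))) ⟩
  sumOver P (val ∘ v)
    ∎
  where open ≤-Reasoning

0<ᵇ-true : ∀ {w} → 0 < w → (0 <ᵇ w) ≡ true
0<ᵇ-true {suc w} _ = refl

0<ᵇ-false : ∀ {w} → (0 <ᵇ w) ≡ false → w ≡ 0
0<ᵇ-false {zero} _ = refl

-- Collapses a group of cells with `twos` 2-labels and total weight `weight`; the flag raises an
-- all-zero group to 1.
label : (twos weight : ℕ) → Bool → R3
label (suc _) _       _     = r2
label zero    (suc _) _     = r1
label zero    zero    true  = r1
label zero    zero    false = r0

val-label : ∀ {t w} b → 2 * t ≤ w → val (label t w b) ≤ w + 𝟙 b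
val-label {suc t} {w}     b     2t≤w = ≤-trans (≤-trans (*-monoʳ-≤ 2 (s≤s z≤n)) 2t≤w) (m≤m+n w _)
val-label {zero}  {suc w} b     _    = s≤s z≤n
val-label {zero}  {zero}  true  _    = ≤-refl
val-label {zero}  {zero}  false _    = z≤n

label≡r0 : ∀ {t w b} → label t w b ≡ r0 → w ≡ 0 × b ≡ false
label≡r0 {zero} {zero} {false} _ = refl , refl

label-r2 : ∀ {t} w b → 0 < t → label t w b ≡ r2
label-r2 {suc t} w b _ = refl

𝟙-positive+twos≤weight : ∀ {t w} → 2 * t ≤ w → 𝟙 (0 <ᵇ w) + t ≤ w
𝟙-positive+twos≤weight {zero}  {zero}  _    = z≤n
𝟙-positive+twos≤weight {zero}  {suc w} _    = s≤s z≤n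
𝟙-positive+twos≤weight {suc t} {suc w} 2t≤w =
  ≤-trans (+-monoˡ-≤ (suc t) (s≤s z≤n)) (≤-trans (≤-reflexive (sym (2*m≡m+m (suc t)))) 2t≤w)

does≡false⇒¬ : ∀ {A : Set} (a? : Dec A) → does a? ≡ false → ¬ A
does≡false⇒¬ (no ¬a) _ = ¬a

∈-tabulate : ∀ {n} {b : Fin n → Bool} {i} → b i ≡ true → i ∈ tabulate b
∈-tabulate {b = b} {i} bi = lookup⇒[]= i (tabulate b) (trans (lookup∘tabulate b i) bi)

∉-tabulate : ∀ {n} {b : Fin n → Bool} {i} → i ∉ tabulate b → b i ≡ false
∉-tabulate {b = b} {i} i∉ with b i in bi
... | true  = ⊥-elim (i∉ (∈-tabulate bi))
... | false = refl

dominator : ∀ G {D} → IsDominating G D → ∀ v → ∃[ u ] (u ∈ D × InClosedNbhd G u v)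
dominator G {D} dom v with v ∈? D
... | yes v∈D = v , v∈D , inj₁ refl
... | no  v∉D = let (u , u∈D , v~u) = dom v v∉D in u , u∈D , inj₂ (Adj-sym G v~u)

HasDisjointClosedNbhds : (G : Graph) → Subset (n G) → Set
HasDisjointClosedNbhds G S = ∀ u v → u ∈ S → v ∈ S → u ≢ v →
  ∀ w → ¬ (InClosedNbhd G u w × InClosedNbhd G v w)

disjoint-closedNbhd-unique : ∀ G {S} → HasDisjointClosedNbhds G S → ∀ {u v w} → u ∈ S → v ∈ S →
  InClosedNbhd G u w → InClosedNbhd G v w → u ≡ v
disjoint-closedNbhd-unique G disj {u} {v} {w} u∈S v∈S uw vw =
  decidable-stable (u ≟ v) λ u≢v → disj u v u∈S v∈S u≢v w (uw , vw)

module _ (G H : Graph) where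

  □-AdjPair : Fin (n G) × Fin (n H) → Fin (n G) × Fin (n H) → Set
  □-AdjPair (g , h) (g' , h') = (g ≡ g' × Adj H h h') ⊎ (Adj G g g' × h ≡ h')

  □-Adj⇒□-AdjPair : ∀ x y → □-Adj G H x y → □-AdjPair (remQuot (n H) x) (remQuot (n H) y)
  □-Adj⇒□-AdjPair x y x~y with remQuot {n G} (n H) x | remQuot {n G} (n H) y
  ... | _ , _ | _ , _ = x~y

module RomanOnProduct (G H : Graph) {f : Fin (n G * n H) → R3} (rdf : IsRomanDominating (G □ H) f) where

  F : Fin (n G) → Fin (n H) → R3
  F g h = f (combine g h)

  VerticalWitness HorizontalWitness : Fin (n G) → Fin (n H) → Set
  VerticalWitness   g h = ∃[ h' ] (Adj H h h' × F g h' ≡ r2)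
  HorizontalWitness g h = ∃[ g' ] (Adj G g g' × F g' h ≡ r2)

  r0⇒witness : ∀ {g h} → F g h ≡ r0 → VerticalWitness g h ⊎ HorizontalWitness g h
  r0⇒witness {g} {h} Fgh≡r0 with rdf (combine g h) Fgh≡r0
  ... | y , gh~y , fy≡r2 with subst (λ p → □-AdjPair G H p (remQuot (n H) y)) (remQuot-combine g h)
                                    (□-Adj⇒□-AdjPair G H (combine g h) y gh~y)
  ...   | inj₁ (refl , h~h') = inj₁ (_ , h~h' , trans (cong f (combine-remQuot {n G} (n H) y)) fy≡r2)
  ...   | inj₂ (g~g' , refl) = inj₂ (_ , g~g' , trans (cong f (combine-remQuot {n G} (n H) y)) fy≡r2)

  data Cell (g : Fin (n G)) (h : Fin (n H)) : Set where
    nonzero    : F g h ≢ r0 → Cell g h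
    vertical   : VerticalWitness g h → Cell g h
    horizontal : HorizontalWitness g h → Cell g h

  classify : ∀ g h → Cell g h
  classify g h with F g h in Fgh
  ... | r0 = [ vertical , horizontal ] (r0⇒witness Fgh)
  ... | r1 = nonzero λ Fgh≡r0 → case trans (sym Fgh) Fgh≡r0 of λ ()
  ... | r2 = nonzero λ Fgh≡r0 → case trans (sym Fgh) Fgh≡r0 of λ ()

  isVertical : ∀ {g h} → Cell g h → Bool
  isVertical (vertical _) = true
  isVertical _            = false

  -- Refers to the witness picked by rdf: a 0 may have 2-neighbours of both kinds.
  verticalᵇ : Fin (n G) → Fin (n H) → Bool
  verticalᵇ g h = isVertical (classify g h)

  verticalᵇ⇒witness : ∀ {g h} → verticalᵇ g h ≡ true → VerticalWitness g h
  verticalᵇ⇒witness {g} {h} = go (classify g h)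
    where
    go : (c : Cell g h) → isVertical c ≡ true → VerticalWitness g h
    go (vertical w) _ = w

  ¬verticalᵇ⇒witness : ∀ {g h} → F g h ≡ r0 → verticalᵇ g h ≡ false → HorizontalWitness g h
  ¬verticalᵇ⇒witness {g} {h} Fgh≡r0 = go (classify g h)
    where
    go : (c : Cell g h) → isVertical c ≡ false → HorizontalWitness g h
    go (nonzero Fgh≢r0) _ = ⊥-elim (Fgh≢r0 Fgh≡r0)
    go (horizontal w)   _ = w

  totalWeight totalTwos : ℕ
  totalWeight = ∑[ g < n G ] ∑[ h < n H ] val (F g h)
  totalTwos   = ∑[ g < n G ] ∑[ h < n H ] 𝟙 (isTwo (F g h))

  weight≡totalWeight : weight (G □ H) f ≡ totalWeight
  weight≡totalWeight = trans (sum-tabulate (val ∘ f)) (sum-combine (n G) (n H) (val ∘ f))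

  module Blocks {S : Subset (n G)} (domS : IsDominating G S) (disj : HasDisjointClosedNbhds G S) where

    β : Fin (n G) → Fin (n G)
    β g = proj₁ (dominator G domS g)

    β∈S : ∀ g → β g ∈ S
    β∈S g = proj₁ (proj₂ (dominator G domS g))

    in-block : ∀ {u g} → u ∈ S → InClosedNbhd G u g → Fibre β u g ≡ true
    in-block {u} {g} u∈S ug = dec-true (β g ≟ u)
      (disjoint-closedNbhd-unique G disj (β∈S g) u∈S (proj₂ (proj₂ (dominator G domS g))) ug)

    blockWeight blockTwos : Fin (n G) → Fin (n H) → ℕ
    blockWeight u h = sumOver (Fibre β u) (λ g → val (F g h))
    blockTwos   u h = sumOver (Fibre β u) (λ g → 𝟙 (isTwo (F g h)))

    module _ {u : Fin (n G)} (u∈S : u ∈ S) where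

      val≤blockWeight : ∀ {g} h → InClosedNbhd G u g → val (F g h) ≤ blockWeight u h
      val≤blockWeight {g} h ug = term≤sumOver (Fibre β u) (λ g → val (F g h)) g (in-block u∈S ug)

      blockWeight≡0⇒zero : ∀ {g h} → blockWeight u h ≡ 0 → InClosedNbhd G u g → F g h ≡ r0
      blockWeight≡0⇒zero {h = h} w≡0 ug =
        val≤0⇒r0 (≤-trans (val≤blockWeight h ug) (≤-reflexive w≡0))

      two⇒blockWeight>0 : ∀ {g h} → F g h ≡ r2 → InClosedNbhd G u g → 0 < blockWeight u h
      two⇒blockWeight>0 {h = h} F≡r2 ug =
        ≤-trans (s≤s z≤n) (subst (λ v → val v ≤ blockWeight u h) F≡r2 (val≤blockWeight h ug))

      two⇒blockTwos>0 : ∀ {g h} → F g h ≡ r2 → InClosedNbhd G u g → 0 < blockTwos u h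
      two⇒blockTwos>0 {g} {h} F≡r2 ug = subst (λ v → 𝟙 (isTwo v) ≤ blockTwos u h) F≡r2
        (term≤sumOver (Fibre β u) (λ g → 𝟙 (isTwo (F g h))) g (in-block u∈S ug))

      blockWeight≡0⇒vertical : ∀ {h} → blockWeight u h ≡ 0 → VerticalWitness u h
      blockWeight≡0⇒vertical w≡0 with r0⇒witness (blockWeight≡0⇒zero w≡0 (inj₁ refl))
      ... | inj₁ vw = vw
      ... | inj₂ (_ , u~g' , F≡r2) =
        case trans (sym F≡r2) (blockWeight≡0⇒zero w≡0 (inj₂ u~g')) of λ ()

      support : Subset (n H)
      support = tabulate (λ h → 0 <ᵇ blockWeight u h)

      support-dominating : IsDominating H support
      support-dominating h h∉ with blockWeight≡0⇒vertical (0<ᵇ-false (∉-tabulate h∉))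
      ... | h' , h~h' , F≡r2 =
        h' , ∈-tabulate (0<ᵇ-true (two⇒blockWeight>0 F≡r2 (inj₁ refl))) , h~h'

      projection : Fin (n H) → R3
      projection h = label (blockTwos u h) (blockWeight u h) false

      projection-roman : IsRomanDominating H projection
      projection-roman h proj≡r0 with blockWeight≡0⇒vertical (proj₁ (label≡r0 proj≡r0))
      ... | h' , h~h' , F≡r2 =
        h' , h~h' , label-r2 (blockWeight u h') false (two⇒blockTwos>0 F≡r2 (inj₁ refl))

      2*blockTwos≤blockWeight : ∀ h → 2 * blockTwos u h ≤ blockWeight u h
      2*blockTwos≤blockWeight h = 2*twos≤weight (Fibre β u) (λ g → F g h)

      block-domination-bound : ∀ {m} → (∀ D → IsDominating H D → m ≤ ∣ D ∣) →
        m + ∑[ h < n H ] blockTwos u h ≤ ∑[ h < n H ] blockWeight u h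
      block-domination-bound {m} γH≤ = begin
        m + sum (blockTwos u)
          ≤⟨ +-monoˡ-≤ (sum (blockTwos u)) (γH≤ support support-dominating) ⟩
        ∣ support ∣ + sum (blockTwos u)
          ≡⟨ cong (_+ sum (blockTwos u)) (∣tabulate∣ (λ h → 0 <ᵇ blockWeight u h)) ⟩
        ∑[ h < n H ] 𝟙 (0 <ᵇ blockWeight u h) + sum (blockTwos u)
          ≡⟨ ∑-distrib-+ (λ h → 𝟙 (0 <ᵇ blockWeight u h)) (blockTwos u) ⟨
        ∑[ h < n H ] (𝟙 (0 <ᵇ blockWeight u h) + blockTwos u h)
          ≤⟨ sum-mono-≤ (λ h → 𝟙-positive+twos≤weight (2*blockTwos≤blockWeight h)) ⟩
        sum (blockWeight u)
          ∎
        where open ≤-Reasoning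

      block-roman-bound : ∀ {r} → (∀ φ → IsRomanDominating H φ → r ≤ weight H φ) →
        r ≤ ∑[ h < n H ] blockWeight u h
      block-roman-bound {r} γR≤ = begin
        r                                  ≤⟨ γR≤ projection projection-roman ⟩
        weight H projection                ≡⟨ sum-tabulate (val ∘ projection) ⟩
        ∑[ h < n H ] val (projection h)
          ≤⟨ sum-mono-≤ (λ h → val-label false (2*blockTwos≤blockWeight h)) ⟩
        ∑[ h < n H ] (blockWeight u h + 0) ≡⟨ sum-cong-≗ (λ h → +-identityʳ (blockWeight u h)) ⟩
        ∑[ h < n H ] blockWeight u h       ∎
        where open ≤-Reasoning

    sum-blocks : (V : Fin (n G) → Fin (n H) → ℕ) →
      sumOver (lookup S) (λ u → ∑[ h < n H ] sumOver (Fibre β u) (λ g → V g h))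
        ≡ ∑[ g < n G ] ∑[ h < n H ] V g h
    sum-blocks = sumOver-fibres₂ (lookup S) β ([]=⇒lookup ∘ β∈S)

    blocks-domination-bound : ∀ {m} → (∀ D → IsDominating H D → m ≤ ∣ D ∣) →
      m * ∣ S ∣ + totalTwos ≤ totalWeight
    blocks-domination-bound {m} γH≤ = begin
      m * ∣ S ∣ + totalTwos
        ≡⟨ cong₂ _+_ (sumOver-const S m) (sum-blocks (λ g h → 𝟙 (isTwo (F g h)))) ⟨
      sumOver (lookup S) (λ _ → m) + sumOver (lookup S) (sum ∘ blockTwos)
        ≡⟨ sumOver-distrib-+ (lookup S) (λ _ → m) (sum ∘ blockTwos) ⟨
      sumOver (lookup S) (λ u → m + sum (blockTwos u))
        ≤⟨ sumOver-mono-≤ (lookup S) (λ u u∈S → block-domination-bound (lookup⇒[]= u S u∈S) γH≤) ⟩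
      sumOver (lookup S) (sum ∘ blockWeight)
        ≡⟨ sum-blocks (λ g h → val (F g h)) ⟩
      totalWeight
        ∎
      where open ≤-Reasoning

    blocks-roman-bound : ∀ {r} → (∀ φ → IsRomanDominating H φ → r ≤ weight H φ) →
      r * ∣ S ∣ ≤ totalWeight
    blocks-roman-bound {r} γR≤ = begin
      r * ∣ S ∣
        ≡⟨ sumOver-const S r ⟨
      sumOver (lookup S) (λ _ → r)
        ≤⟨ sumOver-mono-≤ (lookup S) (λ u u∈S → block-roman-bound (lookup⇒[]= u S u∈S) γR≤) ⟩
      sumOver (lookup S) (sum ∘ blockWeight)
        ≡⟨ sum-blocks (λ g h → val (F g h)) ⟩
      totalWeight
        ∎
      where open ≤-Reasoning

  module Fibres {D : Subset (n H)} (domD : IsDominating H D) where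

    α : Fin (n H) → Fin (n H)
    α h = proj₁ (dominator H domD h)

    α∈D : ∀ h → α h ∈ D
    α∈D h = proj₁ (proj₂ (dominator H domD h))

    α-nbhd : ∀ h → InClosedNbhd H (α h) h
    α-nbhd h = proj₂ (proj₂ (dominator H domD h))

    fibreWeight fibreTwos : Fin (n H) → Fin (n G) → ℕ
    fibreWeight d g = sumOver (Fibre α d) (λ h → val (F g h))
    fibreTwos   d g = sumOver (Fibre α d) (λ h → 𝟙 (isTwo (F g h)))

    Covered : Fin (n H) → Fin (n G) → Set
    Covered d g = ∀ h → α h ≡ d → verticalᵇ g h ≡ true

    covered? : ∀ d g → Dec (Covered d g)
    covered? d g = all? (λ h → (α h ≟ d) →-dec (verticalᵇ g h Bool.≟ true))

    coveredᵇ : Fin (n H) → Fin (n G) → Bool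
    coveredᵇ d g = does (covered? d g)

    uncovered⇒witness : ∀ {d g} → ¬ Covered d g → ∃[ h ] (α h ≡ d × verticalᵇ g h ≡ false)
    uncovered⇒witness {d} {g} ¬cov
      with ¬∀⟶∃¬ (n H) _ (λ h → (α h ≟ d) →-dec (verticalᵇ g h Bool.≟ true)) ¬cov
    ... | h , ¬impl with α h ≟ d | verticalᵇ g h in vertical≡
    ...   | yes αh≡d | false = h , αh≡d , vertical≡
    ...   | yes _    | true  = ⊥-elim (¬impl λ _ → refl)
    ...   | no αh≢d  | _     = ⊥-elim (¬impl λ αh≡d → ⊥-elim (αh≢d αh≡d))

    fibreWeight≡0⇒zero : ∀ {d g h} → fibreWeight d g ≡ 0 → α h ≡ d → F g h ≡ r0
    fibreWeight≡0⇒zero {d} {g} {h} w≡0 αh≡d = val≤0⇒r0 (≤-trans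
      (term≤sumOver (Fibre α d) (λ h → val (F g h)) h (dec-true (α h ≟ d) αh≡d)) (≤-reflexive w≡0))

    two⇒fibreTwos>0 : ∀ {d g h} → F g h ≡ r2 → α h ≡ d → 0 < fibreTwos d g
    two⇒fibreTwos>0 {d} {g} {h} F≡r2 αh≡d = subst (λ v → 𝟙 (isTwo v) ≤ fibreTwos d g) F≡r2
      (term≤sumOver (Fibre α d) (λ h → 𝟙 (isTwo (F g h))) h (dec-true (α h ≟ d) αh≡d))

    uncovered-empty-fibre⇒witness : ∀ {d g} → fibreWeight d g ≡ 0 → ¬ Covered d g →
      ∃[ g' ] (Adj G g g' × 0 < fibreTwos d g')
    uncovered-empty-fibre⇒witness w≡0 ¬cov with uncovered⇒witness ¬cov
    ... | h , αh≡d , notVertical with ¬verticalᵇ⇒witness (fibreWeight≡0⇒zero w≡0 αh≡d) notVertical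
    ...   | g' , g~g' , F≡r2 = g' , g~g' , two⇒fibreTwos>0 F≡r2 αh≡d

    collapse : Fin (n H) → Fin (n G) → R3
    collapse d g = label (fibreTwos d g) (fibreWeight d g) (coveredᵇ d g)

    collapse-roman : ∀ d → IsRomanDominating G (collapse d)
    collapse-roman d g c≡r0 =
      let w≡0 , uncovered = label≡r0 c≡r0
          g' , g~g' , twos>0 = uncovered-empty-fibre⇒witness w≡0 (does≡false⇒¬ (covered? d g) uncovered)
      in g' , g~g' , label-r2 (fibreWeight d g') _ twos>0

    collapse-bound : ∀ {r} → (∀ φ → IsRomanDominating G φ → r ≤ weight G φ) →
      ∀ d → r ≤ ∑[ g < n G ] (fibreWeight d g + 𝟙 (coveredᵇ d g))
    collapse-bound {r} γR≤ d = begin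
      r                                                  ≤⟨ γR≤ (collapse d) (collapse-roman d) ⟩
      weight G (collapse d)                              ≡⟨ sum-tabulate (val ∘ collapse d) ⟩
      ∑[ g < n G ] val (collapse d g)
        ≤⟨ sum-mono-≤ (λ g → val-label _ (2*twos≤weight (Fibre α d) (F g))) ⟩
      ∑[ g < n G ] (fibreWeight d g + 𝟙 (coveredᵇ d g))  ∎
      where open ≤-Reasoning

    -- Replacing the covered members of D by the 2-labelled cells of row g still dominates H.
    twosOrUncovered : Fin (n G) → Fin (n H) → Bool
    twosOrUncovered g h = isTwo (F g h) ∨ (lookup D h ∧ not (coveredᵇ h g))

    two∈twosOrUncovered : ∀ {g h} → F g h ≡ r2 → h ∈ tabulate (twosOrUncovered g)
    two∈twosOrUncovered {g} {h} F≡r2 =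
      ∈-tabulate (cong (λ v → isTwo v ∨ (lookup D h ∧ not (coveredᵇ h g))) F≡r2)

    uncovered∈twosOrUncovered : ∀ {g d} → d ∈ D → ¬ Covered d g → d ∈ tabulate (twosOrUncovered g)
    uncovered∈twosOrUncovered {g} {d} d∈D ¬cov = ∈-tabulate (trans
      (cong₂ (λ a b → isTwo (F g d) ∨ (a ∧ not b)) ([]=⇒lookup d∈D) (dec-false (covered? d g) ¬cov))
      (Bool.∨-zeroʳ (isTwo (F g d))))

    twosOrUncovered-dominating : ∀ g → IsDominating H (tabulate (twosOrUncovered g))
    twosOrUncovered-dominating g h h∉ with covered? (α h) g | α-nbhd h
    ... | yes cov | _ =
      let h' , h~h' , F≡r2 = verticalᵇ⇒witness (cov h refl) in h' , two∈twosOrUncovered F≡r2 , h~h'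
    ... | no ¬cov | inj₂ αh~h = α h , uncovered∈twosOrUncovered (α∈D h) ¬cov , Adj-sym H αh~h
    ... | no ¬cov | inj₁ h≡αh =
      ⊥-elim (h∉ (subst (_∈ _) (sym h≡αh) (uncovered∈twosOrUncovered (α∈D h) ¬cov)))

    coveredCount : Fin (n G) → ℕ
    coveredCount g = sumOver (lookup D) (λ d → 𝟙 (coveredᵇ d g))

    coveredCount≤rowTwos : (∀ D' → IsDominating H D' → ∣ D ∣ ≤ ∣ D' ∣) →
      ∀ g → coveredCount g ≤ ∑[ h < n H ] 𝟙 (isTwo (F g h))
    coveredCount≤rowTwos D-minimum g = +-cancelʳ-≤ uncoveredCount _ _ (begin
      coveredCount g + uncoveredCount
        ≡⟨ sumOver-distrib-+ (lookup D) (𝟙 ∘ covered) (𝟙 ∘ not ∘ covered) ⟨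
      sumOver (lookup D) (λ d → 𝟙 (covered d) + 𝟙 (not (covered d)))
        ≡⟨ sumOver-cong (lookup D) (𝟙+𝟙-not ∘ covered) ⟩
      sumOver (lookup D) (λ _ → 1)
        ≡⟨ trans (sumOver-const D 1) (*-identityˡ ∣ D ∣) ⟩
      ∣ D ∣
        ≤⟨ D-minimum _ (twosOrUncovered-dominating g) ⟩
      ∣ tabulate (twosOrUncovered g) ∣
        ≡⟨ ∣tabulate∣ (twosOrUncovered g) ⟩
      ∑[ h < n H ] 𝟙 (twosOrUncovered g h)
        ≤⟨ sum-mono-≤ (λ h → 𝟙-∨ (isTwo (F g h)) _) ⟩
      ∑[ h < n H ] (𝟙 (isTwo (F g h)) + 𝟙 (lookup D h ∧ not (covered h)))
        ≡⟨ ∑-distrib-+ (λ h → 𝟙 (isTwo (F g h))) _ ⟩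
      rowTwos + ∑[ h < n H ] 𝟙 (lookup D h ∧ not (covered h))
        ≡⟨ cong (rowTwos +_) (sum-cong-≗ (λ h → 𝟙-∧ (lookup D h) _)) ⟩
      rowTwos + uncoveredCount
        ∎)
      where
      open ≤-Reasoning
      covered : Fin (n H) → Bool
      covered d = coveredᵇ d g
      rowTwos uncoveredCount : ℕ
      rowTwos        = ∑[ h < n H ] 𝟙 (isTwo (F g h))
      uncoveredCount = sumOver (lookup D) (λ d → 𝟙 (not (covered d)))

    fibres-bound : ∀ {r} → (∀ φ → IsRomanDominating G φ → r ≤ weight G φ) →
      (∀ D' → IsDominating H D' → ∣ D ∣ ≤ ∣ D' ∣) → r * ∣ D ∣ ≤ totalWeight + totalTwos
    fibres-bound {r} γR≤ D-minimum = begin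
      r * ∣ D ∣
        ≡⟨ sumOver-const D r ⟨
      sumOver (lookup D) (λ _ → r)
        ≤⟨ sumOver-mono-≤ (lookup D) (λ d _ → collapse-bound γR≤ d) ⟩
      sumOver (lookup D) (λ d → ∑[ g < n G ] (fibreWeight d g + 𝟙 (coveredᵇ d g)))
        ≡⟨ sumOver-cong (lookup D) (λ d → ∑-distrib-+ (fibreWeight d) (𝟙 ∘ coveredᵇ d)) ⟩
      sumOver (lookup D) (λ d → sum (fibreWeight d) + sum (𝟙 ∘ coveredᵇ d))
        ≡⟨ sumOver-distrib-+ (lookup D) (sum ∘ fibreWeight) (λ d → sum (𝟙 ∘ coveredᵇ d)) ⟩
      sumOver (lookup D) (sum ∘ fibreWeight) + sumOver (lookup D) (λ d → sum (𝟙 ∘ coveredᵇ d))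
        ≡⟨ cong₂ _+_ sum-fibreWeight (sumOver-sum-comm (lookup D) (λ d g → 𝟙 (coveredᵇ d g))) ⟩
      totalWeight + ∑[ g < n G ] coveredCount g
        ≤⟨ +-monoʳ-≤ totalWeight (sum-mono-≤ (coveredCount≤rowTwos D-minimum)) ⟩
      totalWeight + totalTwos
        ∎
      where
      open ≤-Reasoning
      sum-fibreWeight : sumOver (lookup D) (sum ∘ fibreWeight) ≡ totalWeight
      sum-fibreWeight = trans (sumOver-fibres₂ (lookup D) α ([]=⇒lookup ∘ α∈D) (λ h g → val (F g h)))
                              (∑-comm (λ h g → val (F g h)))

bounds⇒⊔≤2*w : ∀ k m rG rH {w t} → m * k + t ≤ w → rH * k ≤ w → rG * m ≤ w + t →
  (k * (rH + m)) ⊔ (m * (rG + k)) ≤ 2 * w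
bounds⇒⊔≤2*w k m rG rH {w} {t} mk+t≤w rHk≤w rGm≤w+t = ⊔-lub left right
  where
  open ≤-Reasoning
  mk≤w : m * k ≤ w
  mk≤w = ≤-trans (m≤m+n (m * k) t) mk+t≤w
  left : k * (rH + m) ≤ 2 * w
  left = begin
    k * (rH + m)   ≡⟨ trans (*-distribˡ-+ k rH m) (cong₂ _+_ (*-comm k rH) (*-comm k m)) ⟩
    rH * k + m * k ≤⟨ +-mono-≤ rHk≤w mk≤w ⟩
    w + w          ≡⟨ 2*m≡m+m w ⟨
    2 * w          ∎
  right : m * (rG + k) ≤ 2 * w
  right = begin
    m * (rG + k)       ≡⟨ trans (*-distribˡ-+ m rG k) (cong (_+ m * k) (*-comm m rG)) ⟩
    rG * m + m * k     ≤⟨ +-monoˡ-≤ (m * k) rGm≤w+t ⟩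
    w + t + m * k      ≡⟨ trans (+-assoc w t (m * k)) (cong (w +_) (+-comm t (m * k))) ⟩
    w + (m * k + t)    ≤⟨ +-monoʳ-≤ w mk+t≤w ⟩
    w + w              ≡⟨ 2*m≡m+m w ⟨
    2 * w              ∎

corollary7 : (G H : Graph) → InF G →
    (γG γH γRG γRH γRGH : ℕ) →
    IsDominationNumber G γG → IsDominationNumber H γH →
    IsRomanDominationNumber G γRG → IsRomanDominationNumber H γRH →
    IsRomanDominationNumber (G □ H) γRGH →
    (γG * (γRH + γH)) ⊔ (γH * (γRG + γG)) ≤ 2 * γRGH
corollary7 G H (S , S-dominating , S-size , S-disjoint) γG γH γRG γRH γRGH
           γG-def (γH-witness , γH-minimum) (_ , γRG-minimum) (_ , γRH-minimum) (γRGH-witness , _)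
  with γH-witness | γRGH-witness | S-size γG γG-def
... | D , D-dominating , refl | f , rdf , refl | refl =
  subst (λ w → (∣ S ∣ * (γRH + ∣ D ∣)) ⊔ (∣ D ∣ * (γRG + ∣ S ∣)) ≤ 2 * w) (sym weight≡totalWeight)
    (bounds⇒⊔≤2*w ∣ S ∣ ∣ D ∣ γRG γRH
      (blocks-domination-bound γH-minimum)
      (blocks-roman-bound γRH-minimum)
      (fibres-bound γRG-minimum γH-minimum))
  where
  open RomanOnProduct G H rdf
  open Blocks S-dominating S-disjoint
  open Fibres D-dominating
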